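{- For integers $k\ge1$ and $\ell>-k$, $$a_{k,k+\ell}=\begin{cases} F_{\ell+2}+1, & \text{if } k=1,\ \ell\ge0,\\[2pt] 2\sum_{i=0}^{k-2}\binom{\ell}{i}F_{k-i}+2\binom{\ell}{k-1}+\sum_{j=1}^{\ell}\binom{j}{\ell-j+k}, & \text{if } k\ge2,\ \ell\ge0,\\[2pt] F_{k+\ell+1}, & \text{if } k\ge2,\ -k<\ell<0.\end{cases}$$
   Context: $\mathbb{N}=\{1,2,3,\dots\}$, and $\mathcal{N}$ denotes the collection of finite subsets of $\mathbb{N}$. For $E\in\mathcal{N}$ and $k\in\mathbb{N}$, let $\omega_k(E)=\sum_{i\in E,\, i\neq k}1$. For $k,n\in\mathbb{N}$, let $\mathcal{A}_{k,n}=\{E\in\mathcal{N} : E=\emptyset \text{ or } \omega_k(E)<\min E\le \max E\le n\}$ and $a_{k,n}=|\mathcal{A}_{k,n}|$. $(F_n)_{n\ge0}$ is the Fibonacci sequence: $F_0=0$, $F_1=1$, $F_n=F_{n-1}+F_{n-2}$ for $n\ge2$. Binomial coefficients $\binom{a}{b}$ with integers $a\ge 0$, $b\ge0$ and $b>a$ are $0$. -}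

module Defs where

open import Data.Nat using (ℕ; zero; suc; _+_; _∸_; _<_; _≤_; _⊓_; _⊔_)
open import Data.Nat.Properties using (_≟_; _<?_; _≤?_)
open import Data.List using (List; []; _∷_; _++_; map; filter; length; foldr; applyUpTo)
open import Data.Nat.ListAction using (sum)
open import Data.List.Relation.Unary.All using (All; all?)
open import Data.Product using (_×_)
open import Data.Unit using (⊤; tt)
open import Relation.Nullary using (Dec; yes; no; ¬?)
open import Relation.Nullary.Decidable using (_×-dec_)

F : ℕ → ℕ
F zero = 0
F (suc zero) = 1
F (suc (suc n)) = F (suc n) + F n

-- ∑ a b f = f a + f (a+1) + ... + f b   (empty, i.e. 0, when b < a)
∑ : ℕ → ℕ → (ℕ → ℕ) → ℕ
∑ a b f = sum (map f (applyUpTo (a +_) (suc b ∸ a)))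

subsets : ℕ → List (List ℕ)
subsets zero = [] ∷ []
subsets (suc n) = subsets n ++ map (λ E → E ++ (suc n ∷ [])) (subsets n)

ω : ℕ → List ℕ → ℕ
ω k E = length (filter (λ i → ¬? (i ≟ k)) E)

minL : ℕ → List ℕ → ℕ
minL x xs = foldr _⊓_ x xs

maxL : ℕ → List ℕ → ℕ
maxL x xs = foldr _⊔_ x xs

InA : ℕ → ℕ → List ℕ → Set
InA k n [] = ⊤
InA k n (x ∷ xs) = (ω k (x ∷ xs) < minL x xs × minL x xs ≤ maxL x xs) × maxL x xs ≤ n

inA? : (k n : ℕ) (E : List ℕ) → Dec (InA k n E)
inA? k n [] = yes tt
inA? k n (x ∷ xs) = ((ω k (x ∷ xs) <? minL x xs) ×-dec (minL x xs ≤? maxL x xs)) ×-dec (maxL x xs ≤? n)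

-- a_{k,n} = |𝒜_{k,n}|.  Every E ∈ 𝒜_{k,n} is a subset of {1,...,n}
-- (E = ∅, or max E ≤ n), so it suffices to count among subsets of {1,...,n}.
a : ℕ → ℕ → ℕ
a k n = length (filter (inA? k n) (subsets n))

-- Deleting the largest element n + 1 from a nonempty member of 𝒜_{k,n+1} leaves
-- either ∅ or a set E′ ⊆ {1,…,n} with ω_k(E′) + d < min E′, where d = 0 if
-- n + 1 = k and d = 1 otherwise.  Tracking this offset (G below) and translating
-- sets down by it yields, for a′ j m = a_{j,m}, the recursion
-- a′ j (m + 2) = 2 a′ j (m + 1) if j = m + 2, and a′ j (m + 1) + a′ (j − 1) m
-- otherwise.  Below the diagonal (m < j), and for j = 0, this is the Fibonacci
-- recursion.  For k ≥ 2 the closed form satisfies the same recursion in ℓ by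
-- Pascal's rule; for k = 1 its remaining sum is a shallow diagonal of Pascal's
-- triangle, which sums to a Fibonacci number.
module Submission where

open import Defs
open import Data.Nat using (ℕ; zero; suc; _+_; _∸_; _*_; _≤_; _<_; pred; z≤n; s≤s; _⊓_)
open import Data.Nat.Properties
open import Data.Nat.Combinatorics using (_C_; nCk+nC[k+1]≡[n+1]C[k+1]; k>n⇒nCk≡0)
open import Data.Nat.ListAction using (sum)
open import Data.Nat.ListAction.Properties using (sum-++)
open import Data.Nat.Tactic.RingSolver using (solve-∀)
open import Data.List using (List; []; _∷_; _++_; [_]; map; filter; length; foldr; applyUpTo)
open import Data.List.Properties
  using (map-++; map-∘; map-cong-local; foldr-++; filter-++; length-++; filter-accept; filter-reject)
open import Data.List.Relation.Unary.All as All using (All; []; _∷_)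
open import Data.List.Relation.Unary.All.Properties using (++⁺; map⁺)
open import Data.Product using (_×_; _,_)
open import Data.Bool using (if_then_else_)
open import Function using (_∘_)
open import Relation.Nullary using (Dec; yes; no; ¬_; does; ¬?; contradiction; _×-dec_)
open import Relation.Nullary.Decidable using (dec-true; dec-false)
open import Relation.Unary using (Pred; Decidable)
open import Relation.Binary.PropositionalEquality hiding ([_])
open ≡-Reasoning

indicator : ∀ {p} {A : Set p} → Dec A → ℕ
indicator (yes _) = 1
indicator (no _) = 0

indicator-yes : ∀ {p} {A : Set p} (a? : Dec A) → A → indicator a? ≡ 1
indicator-yes (yes _) _ = refl
indicator-yes (no ¬a) a = contradiction a ¬a

indicator-no : ∀ {p} {A : Set p} (a? : Dec A) → ¬ A → indicator a? ≡ 0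
indicator-no (yes a) ¬a = contradiction a ¬a
indicator-no (no _) _ = refl

indicator-×-decˡ : ∀ {p q} {A : Set p} {B : Set q} (a? : Dec A) (b? : Dec B) → B →
                   indicator (a? ×-dec b?) ≡ indicator a?
indicator-×-decˡ (yes _) (yes _) _ = refl
indicator-×-decˡ (yes _) (no ¬b) b = contradiction b ¬b
indicator-×-decˡ (no _) _ _ = refl

length-filter : ∀ {A : Set} {p} {P : Pred A p} (P? : Decidable P) xs →
                length (filter P? xs) ≡ sum (map (indicator ∘ P?) xs)
length-filter P? [] = refl
length-filter P? (x ∷ xs) with P? x
... | yes _ = cong suc (length-filter P? xs)
... | no _ = length-filter P? xs

module _ {A : Set} where

  sum-map-++ : ∀ (f : A → ℕ) xs ys → sum (map f (xs ++ ys)) ≡ sum (map f xs) + sum (map f ys)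
  sum-map-++ f xs ys = trans (cong sum (map-++ f xs ys)) (sum-++ (map f xs) (map f ys))

  sum-map-+ : ∀ (f g : A → ℕ) xs →
              sum (map (λ x → f x + g x) xs) ≡ sum (map f xs) + sum (map g xs)
  sum-map-+ f g [] = refl
  sum-map-+ f g (x ∷ xs) = begin
    f x + g x + sum (map (λ x → f x + g x) xs)     ≡⟨ cong (f x + g x +_) (sum-map-+ f g xs) ⟩
    f x + g x + (sum (map f xs) + sum (map g xs))  ≡⟨ +-+-comm (f x) (g x) _ _ ⟩
    f x + sum (map f xs) + (g x + sum (map g xs))  ∎
    where
    +-+-comm : ∀ a b c d → a + b + (c + d) ≡ a + c + (b + d)
    +-+-comm = solve-∀

  sum-map-zero : ∀ {f : A → ℕ} {xs} → All (λ x → f x ≡ 0) xs → sum (map f xs) ≡ 0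
  sum-map-zero [] = refl
  sum-map-zero (fx≡0 ∷ fxs≡0) = cong₂ _+_ fx≡0 (sum-map-zero fxs≡0)

ω-++ : ∀ k E E′ → ω k (E ++ E′) ≡ ω k E + ω k E′
ω-++ k E E′ = trans (cong length (filter-++ (λ i → ¬? (i ≟ k)) E E′)) (length-++ (filter _ E))

ω-[k] : ∀ k → ω k [ k ] ≡ 0
ω-[k] k = cong length (filter-reject (λ i → ¬? (i ≟ k)) (λ k≢k → k≢k refl))

ω-[x] : ∀ {k x} → x ≢ k → ω k [ x ] ≡ 1
ω-[x] {k} x≢k = cong length (filter-accept (λ i → ¬? (i ≟ k)) x≢k)

minL≤ : ∀ x xs → minL x xs ≤ x
minL≤ x [] = ≤-refl
minL≤ x (y ∷ ys) = ≤-trans (m⊓n≤n y _) (minL≤ x ys)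

minL-∷ʳ : ∀ {x y} xs → x ≤ y → minL x (xs ++ [ y ]) ≡ minL x xs
minL-∷ʳ {x} {y} xs x≤y =
  trans (foldr-++ _⊓_ x xs [ y ]) (cong (λ z → foldr _⊓_ z xs) (m≥n⇒m⊓n≡n x≤y))

≤maxL : ∀ x xs → x ≤ maxL x xs
≤maxL x [] = ≤-refl
≤maxL x (y ∷ ys) = ≤-trans (≤maxL x ys) (m≤n⊔m y _)

maxL≤ : ∀ {n} x xs → x ≤ n → All (_≤ n) xs → maxL x xs ≤ n
maxL≤ x [] x≤n [] = x≤n
maxL≤ x (y ∷ ys) x≤n (y≤n ∷ ys≤n) = ⊔-lub y≤n (maxL≤ x ys x≤n ys≤n)

All-≤-subsets : ∀ n → All (All (_≤ n)) (subsets n)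
All-≤-subsets zero = [] ∷ []
All-≤-subsets (suc n) =
  ++⁺ (All.map weaken (All-≤-subsets n))
      (map⁺ (All.map (λ E≤n → ++⁺ (weaken E≤n) (≤-refl ∷ [])) (All-≤-subsets n)))
  where
  weaken : ∀ {E} → All (_≤ n) E → All (_≤ suc n) E
  weaken = All.map m≤n⇒m≤1+n

sum-subsets-suc : ∀ (h : List ℕ → ℕ) n →
                  sum (map h (subsets (suc n))) ≡
                  sum (map h (subsets n)) + sum (map (λ E → h (E ++ [ suc n ])) (subsets n))
sum-subsets-suc h n = trans (sum-map-++ h (subsets n) _)
                            (cong (λ s → sum (map h (subsets n)) + sum s) (sym (map-∘ (subsets n))))

emptyIndicator : List ℕ → ℕ
emptyIndicator [] = 1
emptyIndicator (_ ∷ _) = 0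

sum-emptyIndicator : ∀ c n → sum (map (λ E → emptyIndicator E * c) (subsets n)) ≡ c
sum-emptyIndicator c zero = trans (+-identityʳ (c + 0)) (+-identityʳ c)
sum-emptyIndicator c (suc n) = begin
  sum (map (λ E → emptyIndicator E * c) (subsets (suc n)))
    ≡⟨ sum-subsets-suc (λ E → emptyIndicator E * c) n ⟩
  sum (map (λ E → emptyIndicator E * c) (subsets n)) + _
    ≡⟨ cong₂ _+_ (sum-emptyIndicator c n) (sum-map-zero (All.universal appended-nonempty (subsets n))) ⟩
  c + 0
    ≡⟨ +-identityʳ c ⟩
  c ∎
  where
  appended-nonempty : ∀ E → emptyIndicator (E ++ [ suc n ]) * c ≡ 0
  appended-nonempty [] = refl
  appended-nonempty (_ ∷ _) = refl

good : ℕ → ℕ → List ℕ → ℕ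
good k t [] = 0
good k t (x ∷ xs) = indicator (ω k (x ∷ xs) + t <? minL x xs)

G : ℕ → ℕ → ℕ → ℕ
G k t n = sum (map (good k t) (subsets n))

a≡G+1 : ∀ k n → a k n ≡ G k 0 n + 1
a≡G+1 k n = begin
  a k n
    ≡⟨ length-filter (inA? k n) (subsets n) ⟩
  sum (map (indicator ∘ inA? k n) (subsets n))
    ≡⟨ cong sum (map-cong-local (All.map split (All-≤-subsets n))) ⟩
  sum (map (λ E → emptyIndicator E * 1 + good k 0 E) (subsets n))
    ≡⟨ sum-map-+ (λ E → emptyIndicator E * 1) (good k 0) (subsets n) ⟩
  sum (map (λ E → emptyIndicator E * 1) (subsets n)) + G k 0 n
    ≡⟨ cong (_+ G k 0 n) (sum-emptyIndicator 1 n) ⟩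
  1 + G k 0 n
    ≡⟨ +-comm 1 (G k 0 n) ⟩
  G k 0 n + 1 ∎
  where
  split : ∀ {E} → All (_≤ n) E → indicator (inA? k n E) ≡ emptyIndicator E * 1 + good k 0 E
  split {[]} _ = refl
  split {x ∷ xs} (x≤n ∷ xs≤n) = begin
    indicator (inA? k n (x ∷ xs))
      ≡⟨ indicator-×-decˡ _ (maxL x xs ≤? n) (maxL≤ x xs x≤n xs≤n) ⟩
    indicator ((ω k (x ∷ xs) <? minL x xs) ×-dec (minL x xs ≤? maxL x xs))
      ≡⟨ indicator-×-decˡ _ _ (≤-trans (minL≤ x xs) (≤maxL x xs)) ⟩
    indicator (ω k (x ∷ xs) <? minL x xs)
      ≡⟨ cong (λ w → indicator (w <? minL x xs)) (sym (+-identityʳ _)) ⟩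
    good k 0 (x ∷ xs) ∎

G-vanishes : ∀ {k t n} → n ≤ t → G k t n ≡ 0
G-vanishes {k} {t} {n} n≤t = sum-map-zero (All.map no-good (All-≤-subsets n))
  where
  no-good : ∀ {E} → All (_≤ n) E → good k t E ≡ 0
  no-good {[]} _ = refl
  no-good {x ∷ xs} (x≤n ∷ _) = indicator-no _ λ lt →
    <⇒≱ lt (≤-trans (minL≤ x xs) (≤-trans x≤n (≤-trans n≤t (m≤n+m t (ω k (x ∷ xs))))))

good-∷ʳ : ∀ k t n E → All (_≤ n) E →
          good k t (E ++ [ suc n ]) ≡
          good k (ω k [ suc n ] + t) E + emptyIndicator E * indicator (ω k [ suc n ] + t <? suc n)
good-∷ʳ k t n [] [] = sym (+-identityʳ _)
good-∷ʳ k t n (x ∷ xs) (x≤n ∷ _) = begin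
  indicator (ω k (x ∷ xs ++ [ suc n ]) + t <? minL x (xs ++ [ suc n ]))
    ≡⟨ cong₂ (λ w μ → indicator (w + t <? μ)) (ω-++ k (x ∷ xs) [ suc n ]) (minL-∷ʳ xs (m≤n⇒m≤1+n x≤n)) ⟩
  indicator (ω k (x ∷ xs) + d + t <? minL x xs)
    ≡⟨ cong (λ w → indicator (w <? minL x xs)) (+-assoc (ω k (x ∷ xs)) d t) ⟩
  good k (d + t) (x ∷ xs)
    ≡⟨ sym (+-identityʳ _) ⟩
  good k (d + t) (x ∷ xs) + 0 ∎
  where
  d = ω k [ suc n ]

G-suc : ∀ k t n → let d = ω k [ suc n ] in
        G k t (suc n) ≡ G k t n + (G k (d + t) n + indicator (d + t <? suc n))
G-suc k t n = begin
  G k t (suc n)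
    ≡⟨ sum-subsets-suc (good k t) n ⟩
  G k t n + sum (map (λ E → good k t (E ++ [ suc n ])) (subsets n))
    ≡⟨ cong (λ s → G k t n + sum s) (map-cong-local (All.map (good-∷ʳ k t n _) (All-≤-subsets n))) ⟩
  G k t n + sum (map (λ E → good k (d + t) E + emptyIndicator E * c) (subsets n))
    ≡⟨ cong (G k t n +_) (sum-map-+ (good k (d + t)) (λ E → emptyIndicator E * c) (subsets n)) ⟩
  G k t n + (G k (d + t) n + sum (map (λ E → emptyIndicator E * c) (subsets n)))
    ≡⟨ cong (λ s → G k t n + (G k (d + t) n + s)) (sum-emptyIndicator c n) ⟩
  G k t n + (G k (d + t) n + c) ∎
  where
  d = ω k [ suc n ]
  c = indicator (d + t <? suc n)

G-suc-exempt : ∀ {t n} → t ≤ n → G (suc n) t (suc n) ≡ G (suc n) t n + (G (suc n) t n + 1)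
G-suc-exempt {t} {n} t≤n
  rewrite G-suc (suc n) t n | ω-[k] (suc n) | indicator-yes (t <? suc n) (s≤s t≤n) = refl

G-suc-nonexempt : ∀ {k t n} → suc n ≢ k →
                  G k t (suc n) ≡ G k t n + (G k (suc t) n + indicator (suc t <? suc n))
G-suc-nonexempt {k} {t} {n} n+1≢k rewrite G-suc k t n | ω-[x] n+1≢k = refl

-- a′ j m = a j m, where j = 0 stands for “no element is exempt from ω”.
a′ : ℕ → ℕ → ℕ
a′ j zero = 1
a′ j (suc zero) = if does (j ≟ 1) then 2 else 1
a′ j (suc (suc m)) =
  if does (j ≟ suc (suc m)) then 2 * a′ j (suc m) else a′ j (suc m) + a′ (pred j) m

a′-diag : ∀ m → a′ (suc m) (suc m) ≡ 2 * a′ (suc m) m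
a′-diag zero = refl
a′-diag (suc m) rewrite dec-true (suc (suc m) ≟ suc (suc m)) refl = refl

a′-at-1 : ∀ {j} → j ≢ 1 → a′ j 1 ≡ 1
a′-at-1 {j} j≢1 rewrite dec-false (j ≟ 1) j≢1 = refl

a′-off-diag : ∀ {j m} → j ≢ suc (suc m) → a′ j (suc (suc m)) ≡ a′ j (suc m) + a′ (pred j) m
a′-off-diag {j} {m} j≢m+2 rewrite dec-false (j ≟ suc (suc m)) j≢m+2 = refl

m∸n≡1+o⇒1+n+o≡m : ∀ {m n o} → m ∸ n ≡ suc o → suc (n + o) ≡ m
m∸n≡1+o⇒1+n+o≡m {zero} {zero} ()
m∸n≡1+o⇒1+n+o≡m {zero} {suc n} ()
m∸n≡1+o⇒1+n+o≡m {suc m} {zero} eq = sym eq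
m∸n≡1+o⇒1+n+o≡m {suc m} {suc n} eq = cong suc (m∸n≡1+o⇒1+n+o≡m eq)

G-shift : ∀ k m t → G k t (t + m) + 1 ≡ a′ (k ∸ t) m
G-shift k zero t = cong (_+ 1) (G-vanishes (≤-reflexive (+-identityʳ t)))
G-shift k (suc m) t rewrite +-suc t m with suc (t + m) ≟ k
... | yes refl = begin
  G k′ t (suc (t + m)) + 1                    ≡⟨ cong (_+ 1) (G-suc-exempt (m≤m+n t m)) ⟩
  G k′ t (t + m) + (G k′ t (t + m) + 1) + 1   ≡⟨ double (G k′ t (t + m)) ⟩
  2 * (G k′ t (t + m) + 1)                    ≡⟨ cong (2 *_) (G-shift k′ m t) ⟩
  2 * a′ (k′ ∸ t) m                           ≡⟨ cong (λ j → 2 * a′ j m) k′∸t ⟩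
  2 * a′ (suc m) m                            ≡⟨ a′-diag m ⟨
  a′ (suc m) (suc m)                          ≡⟨ cong (λ j → a′ j (suc m)) k′∸t ⟨
  a′ (k′ ∸ t) (suc m)                         ∎
  where
  k′ = suc (t + m)
  k′∸t : k′ ∸ t ≡ suc m
  k′∸t = trans (cong (_∸ t) (sym (+-suc t m))) (m+n∸m≡n t (suc m))
  double : ∀ g → g + (g + 1) + 1 ≡ 2 * (g + 1)
  double = solve-∀
G-shift k (suc zero) t | no t+1≢k rewrite +-identityʳ t = begin
  G k t (suc t) + 1
    ≡⟨ cong (_+ 1) (G-suc-nonexempt t+1≢k) ⟩
  G k t t + (G k (suc t) t + indicator (suc t <? suc t)) + 1
    ≡⟨ cong₂ (λ g h → g + (h + indicator (suc t <? suc t)) + 1)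
             (G-vanishes {k} {t} ≤-refl) (G-vanishes {k} (n≤1+n t)) ⟩
  indicator (suc t <? suc t) + 1
    ≡⟨ cong (_+ 1) (indicator-no (suc t <? suc t) (<-irrefl refl)) ⟩
  1
    ≡⟨ a′-at-1 k∸t≢1 ⟨
  a′ (k ∸ t) 1 ∎
  where
  k∸t≢1 : k ∸ t ≢ 1
  k∸t≢1 k∸t≡1 = t+1≢k (subst (λ n → suc n ≡ k) (+-identityʳ t) (m∸n≡1+o⇒1+n+o≡m k∸t≡1))
G-shift k (suc (suc m)) t | no t+m+2≢k = begin
  G k t (suc (t + suc m)) + 1
    ≡⟨ cong (_+ 1) (G-suc-nonexempt t+m+2≢k) ⟩
  G k t (t + suc m) + (G k (suc t) (t + suc m) + indicator (suc t <? suc (t + suc m))) + 1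
    ≡⟨ cong (λ i → G k t (t + suc m) + (G k (suc t) (t + suc m) + i) + 1)
            (indicator-yes (suc t <? suc (t + suc m)) (s≤s (m<m+n t (s≤s z≤n)))) ⟩
  G k t (t + suc m) + (G k (suc t) (t + suc m) + 1) + 1
    ≡⟨ regroup (G k t (t + suc m)) (G k (suc t) (t + suc m)) ⟩
  (G k t (t + suc m) + 1) + (G k (suc t) (t + suc m) + 1)
    ≡⟨ cong₂ _+_ (G-shift k (suc m) t)
                 (trans (cong (λ n → G k (suc t) n + 1) (+-suc t m)) (G-shift k m (suc t))) ⟩
  a′ (k ∸ t) (suc m) + a′ (k ∸ suc t) m
    ≡⟨ cong (λ j → a′ (k ∸ t) (suc m) + a′ j m) (pred[m∸n]≡m∸[1+n] k t) ⟨
  a′ (k ∸ t) (suc m) + a′ (pred (k ∸ t)) m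
    ≡⟨ a′-off-diag (t+m+2≢k ∘ m∸n≡1+o⇒1+n+o≡m) ⟨
  a′ (k ∸ t) (suc (suc m)) ∎
  where
  regroup : ∀ g h → g + (h + 1) + 1 ≡ (g + 1) + (h + 1)
  regroup = solve-∀

a≡a′ : ∀ k n → a k n ≡ a′ k n
a≡a′ k n = trans (a≡G+1 k n) (G-shift k n 0)

a′-below-diag : ∀ {j m} → m < j → a′ j m ≡ F (suc m)
a′-below-diag {m = zero} _ = refl
a′-below-diag {j} {suc zero} 1<j = a′-at-1 {j} λ { refl → <-irrefl refl 1<j }
a′-below-diag {suc j} {suc (suc m)} (s≤s m+1<j) = begin
  a′ (suc j) (suc (suc m))
    ≡⟨ a′-off-diag (λ j+1≡m+2 → <-irrefl (sym (suc-injective j+1≡m+2)) m+1<j) ⟩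
  a′ (suc j) (suc m) + a′ j m
    ≡⟨ cong₂ _+_ (a′-below-diag (m<n⇒m<1+n m+1<j)) (a′-below-diag (<-trans (n<1+n m) m+1<j)) ⟩
  F (suc (suc (suc m))) ∎

a′-0 : ∀ m → a′ 0 m ≡ F (suc m)
a′-0 zero = refl
a′-0 (suc zero) = refl
a′-0 (suc (suc m)) = trans (a′-off-diag {0} {m} (λ ())) (cong₂ _+_ (a′-0 (suc m)) (a′-0 m))

a′-1 : ∀ ℓ → a′ 1 (suc ℓ) ≡ F (suc (suc ℓ)) + 1
a′-1 zero = refl
a′-1 (suc ℓ) = begin
  a′ 1 (suc (suc ℓ))               ≡⟨ a′-off-diag {1} {ℓ} (λ ()) ⟩
  a′ 1 (suc ℓ) + a′ 0 ℓ            ≡⟨ cong₂ _+_ (a′-1 ℓ) (a′-0 ℓ) ⟩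
  F (suc (suc ℓ)) + 1 + F (suc ℓ)  ≡⟨ swap (F (suc (suc ℓ))) (F (suc ℓ)) ⟩
  F (suc (suc ℓ)) + F (suc ℓ) + 1  ∎
  where
  swap : ∀ x y → x + 1 + y ≡ x + y + 1
  swap = solve-∀

∑< : ℕ → (ℕ → ℕ) → ℕ
∑< zero f = 0
∑< (suc n) f = f 0 + ∑< n (f ∘ suc)

syntax ∑< n (λ i → e) = ∑[ i < n ] e

sum-applyUpTo : ∀ (f g : ℕ → ℕ) n → sum (map f (applyUpTo g n)) ≡ ∑[ i < n ] f (g i)
sum-applyUpTo f g zero = refl
sum-applyUpTo f g (suc n) = cong (f (g 0) +_) (sum-applyUpTo f (g ∘ suc) n)

∑≡∑< : ∀ m n f → ∑ m n f ≡ ∑[ i < suc n ∸ m ] f (m + i)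
∑≡∑< m n f = sum-applyUpTo f (m +_) (suc n ∸ m)

∑<-cong : ∀ {f g : ℕ → ℕ} n → (∀ i → i < n → f i ≡ g i) → ∑< n f ≡ ∑< n g
∑<-cong zero _ = refl
∑<-cong (suc n) f≡g = cong₂ _+_ (f≡g 0 (s≤s z≤n)) (∑<-cong n (λ i i<n → f≡g (suc i) (s≤s i<n)))

∑<-+ : ∀ (f g : ℕ → ℕ) n → ∑[ i < n ] (f i + g i) ≡ ∑< n f + ∑< n g
∑<-+ f g zero = refl
∑<-+ f g (suc n) = begin
  f 0 + g 0 + ∑[ i < n ] (f (suc i) + g (suc i))  ≡⟨ cong (f 0 + g 0 +_) (∑<-+ (f ∘ suc) (g ∘ suc) n) ⟩
  f 0 + g 0 + (∑< n (f ∘ suc) + ∑< n (g ∘ suc))   ≡⟨ +-+-comm (f 0) (g 0) _ _ ⟩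
  f 0 + ∑< n (f ∘ suc) + (g 0 + ∑< n (g ∘ suc))   ∎
  where
  +-+-comm : ∀ a b c d → a + b + (c + d) ≡ a + c + (b + d)
  +-+-comm = solve-∀

∑<-zero : ∀ n → ∑[ i < n ] 0 ≡ 0
∑<-zero zero = refl
∑<-zero (suc n) = ∑<-zero n

∑<-suc : ∀ (f : ℕ → ℕ) n → ∑< (suc n) f ≡ ∑< n f + f n
∑<-suc f zero = +-comm (f 0) 0
∑<-suc f (suc n) = trans (cong (f 0 +_) (∑<-suc (f ∘ suc) n)) (sym (+-assoc (f 0) _ _))

pascal : ∀ n k → suc n C suc k ≡ n C k + n C suc k
pascal n k = sym (nCk+nC[k+1]≡[n+1]C[k+1] n k)

pascalDiagonal : ℕ → ℕ → ℕ
pascalDiagonal k ℓ = ∑[ j < ℓ ] (suc j C (ℓ ∸ suc j + k))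

pascalDiagonal-suc : ∀ k ℓ → 0 < ℓ + k →
                     pascalDiagonal (suc k) (suc ℓ) ≡ pascalDiagonal k ℓ + pascalDiagonal (suc k) ℓ
pascalDiagonal-suc k ℓ 0<ℓ+k = begin
  1 C (ℓ + suc k) + ∑[ j < ℓ ] (suc (suc j) C (ℓ ∸ suc j + suc k))
    ≡⟨ cong₂ _+_ (k>n⇒nCk≡0 (≤-trans (s≤s 0<ℓ+k) (≤-reflexive (sym (+-suc ℓ k)))))
                 (∑<-cong ℓ (λ j _ → pascal-at j)) ⟩
  0 + ∑[ j < ℓ ] (suc j C (ℓ ∸ suc j + k) + suc j C (ℓ ∸ suc j + suc k))
    ≡⟨ ∑<-+ _ _ ℓ ⟩
  pascalDiagonal k ℓ + pascalDiagonal (suc k) ℓ ∎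
  where
  pascal-at : ∀ j → suc (suc j) C (ℓ ∸ suc j + suc k) ≡
                    suc j C (ℓ ∸ suc j + k) + suc j C (ℓ ∸ suc j + suc k)
  pascal-at j rewrite +-suc (ℓ ∸ suc j) k = pascal (suc j) (ℓ ∸ suc j + k)

pascalDiagonal-0-suc : ∀ ℓ → pascalDiagonal 0 (suc ℓ) ≡ pascalDiagonal 1 ℓ + 1
pascalDiagonal-0-suc ℓ = begin
  pascalDiagonal 0 (suc ℓ)
    ≡⟨ ∑<-suc _ ℓ ⟩
  ∑[ j < ℓ ] (suc j C (ℓ ∸ j + 0)) + suc ℓ C (ℓ ∸ ℓ + 0)
    ≡⟨ cong₂ _+_ (∑<-cong ℓ shift) (cong (λ i → suc ℓ C (i + 0)) (n∸n≡0 ℓ)) ⟩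
  pascalDiagonal 1 ℓ + 1 ∎
  where
  shift : ∀ j → j < ℓ → suc j C (ℓ ∸ j + 0) ≡ suc j C (ℓ ∸ suc j + 1)
  shift j j<ℓ = cong (suc j C_) (begin
    ℓ ∸ j + 0        ≡⟨ +-identityʳ (ℓ ∸ j) ⟩
    ℓ ∸ j            ≡⟨ +-∸-assoc 1 j<ℓ ⟩
    1 + (ℓ ∸ suc j)  ≡⟨ +-comm 1 (ℓ ∸ suc j) ⟩
    ℓ ∸ suc j + 1    ∎)

pascalDiagonal-1 : ∀ ℓ → pascalDiagonal 1 ℓ + 1 ≡ F (suc (suc ℓ))
pascalDiagonal-1 zero = refl
pascalDiagonal-1 (suc zero) = refl
pascalDiagonal-1 (suc (suc ℓ)) = begin
  pascalDiagonal 1 (suc (suc ℓ)) + 1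
    ≡⟨ cong (_+ 1) (pascalDiagonal-suc 0 (suc ℓ) (s≤s z≤n)) ⟩
  pascalDiagonal 0 (suc ℓ) + pascalDiagonal 1 (suc ℓ) + 1
    ≡⟨ cong (λ p → p + pascalDiagonal 1 (suc ℓ) + 1) (pascalDiagonal-0-suc ℓ) ⟩
  pascalDiagonal 1 ℓ + 1 + pascalDiagonal 1 (suc ℓ) + 1
    ≡⟨ swap (pascalDiagonal 1 ℓ + 1) (pascalDiagonal 1 (suc ℓ)) ⟩
  pascalDiagonal 1 (suc ℓ) + 1 + (pascalDiagonal 1 ℓ + 1)
    ≡⟨ cong₂ _+_ (pascalDiagonal-1 (suc ℓ)) (pascalDiagonal-1 ℓ) ⟩
  F (suc (suc (suc (suc ℓ)))) ∎
  where
  swap : ∀ x y → x + y + 1 ≡ y + 1 + x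
  swap = solve-∀

fibonacciBinomialSum : ℕ → ℕ → ℕ
fibonacciBinomialSum k ℓ = ∑[ i < k ∸ 1 ] ((ℓ C i) * F (k ∸ i))

fibonacciBinomialSum-suc : ∀ k ℓ → fibonacciBinomialSum (suc (suc k)) (suc ℓ) ≡
                           fibonacciBinomialSum (suc (suc k)) ℓ + fibonacciBinomialSum (suc k) ℓ
fibonacciBinomialSum-suc k ℓ = begin
  F (suc (suc k)) + 0 + ∑[ i < k ] ((suc ℓ C suc i) * F (suc k ∸ i))
    ≡⟨ cong (F (suc (suc k)) + 0 +_) (∑<-cong k (λ i _ → pascal-at i)) ⟩
  F (suc (suc k)) + 0 + ∑[ i < k ] ((ℓ C i) * F (suc k ∸ i) + (ℓ C suc i) * F (suc k ∸ i))
    ≡⟨ cong (F (suc (suc k)) + 0 +_) (∑<-+ _ _ k) ⟩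
  F (suc (suc k)) + 0 + (fibonacciBinomialSum (suc k) ℓ + ∑[ i < k ] ((ℓ C suc i) * F (suc k ∸ i)))
    ≡⟨ swap (F (suc (suc k)) + 0) (fibonacciBinomialSum (suc k) ℓ) _ ⟩
  fibonacciBinomialSum (suc (suc k)) ℓ + fibonacciBinomialSum (suc k) ℓ ∎
  where
  pascal-at : ∀ i → (suc ℓ C suc i) * F (suc k ∸ i) ≡
                    (ℓ C i) * F (suc k ∸ i) + (ℓ C suc i) * F (suc k ∸ i)
  pascal-at i = trans (cong (_* F (suc k ∸ i)) (pascal ℓ i)) (*-distribʳ-+ (F (suc k ∸ i)) (ℓ C i) (ℓ C suc i))
  swap : ∀ x y z → x + (y + z) ≡ x + z + y
  swap = solve-∀

closedForm : ℕ → ℕ → ℕ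
closedForm k ℓ = 2 * fibonacciBinomialSum k ℓ + 2 * (ℓ C (k ∸ 1)) + pascalDiagonal k ℓ

closedForm-1 : ∀ ℓ → closedForm 1 ℓ ≡ F (suc (suc ℓ)) + 1
closedForm-1 ℓ = begin
  2 + pascalDiagonal 1 ℓ      ≡⟨ +-comm 2 (pascalDiagonal 1 ℓ) ⟩
  pascalDiagonal 1 ℓ + 2      ≡⟨ +-assoc (pascalDiagonal 1 ℓ) 1 1 ⟨
  pascalDiagonal 1 ℓ + 1 + 1  ≡⟨ cong (_+ 1) (pascalDiagonal-1 ℓ) ⟩
  F (suc (suc ℓ)) + 1         ∎

closedForm-zero : ∀ k → closedForm (suc (suc k)) 0 ≡ 2 * F (suc (suc k))
closedForm-zero k = begin
  2 * (F (suc (suc k)) + 0 + ∑[ i < k ] 0) + 2 * 0 + 0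
    ≡⟨ cong (λ s → 2 * (F (suc (suc k)) + 0 + s) + 2 * 0 + 0) (∑<-zero k) ⟩
  2 * (F (suc (suc k)) + 0 + 0) + 2 * 0 + 0
    ≡⟨ drop-zeros (F (suc (suc k))) ⟩
  2 * F (suc (suc k)) ∎
  where
  drop-zeros : ∀ x → 2 * (x + 0 + 0) + 2 * 0 + 0 ≡ 2 * x
  drop-zeros = solve-∀

closedForm-suc : ∀ k ℓ → closedForm (suc (suc k)) (suc ℓ) ≡
                         closedForm (suc (suc k)) ℓ + closedForm (suc k) ℓ
closedForm-suc k ℓ = begin
  2 * fibonacciBinomialSum (suc (suc k)) (suc ℓ) + 2 * (suc ℓ C suc k) + pascalDiagonal (suc (suc k)) (suc ℓ)
    ≡⟨ cong₂ (λ s d → 2 * s + 2 * (suc ℓ C suc k) + d) (fibonacciBinomialSum-suc k ℓ)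
             (pascalDiagonal-suc (suc k) ℓ (≤-trans (s≤s z≤n) (m≤n+m (suc k) ℓ))) ⟩
  2 * (S₂ + S₁) + 2 * (suc ℓ C suc k) + (D₁ + D₂)
    ≡⟨ cong (λ c → 2 * (S₂ + S₁) + 2 * c + (D₁ + D₂)) (pascal ℓ k) ⟩
  2 * (S₂ + S₁) + 2 * (ℓ C k + ℓ C suc k) + (D₁ + D₂)
    ≡⟨ regroup S₂ S₁ (ℓ C k) (ℓ C suc k) D₁ D₂ ⟩
  2 * S₂ + 2 * (ℓ C suc k) + D₂ + (2 * S₁ + 2 * (ℓ C k) + D₁) ∎
  where
  S₁ = fibonacciBinomialSum (suc k) ℓ
  S₂ = fibonacciBinomialSum (suc (suc k)) ℓ
  D₁ = pascalDiagonal (suc k) ℓ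
  D₂ = pascalDiagonal (suc (suc k)) ℓ
  regroup : ∀ s₂ s₁ c₁ c₂ d₁ d₂ → 2 * (s₂ + s₁) + 2 * (c₁ + c₂) + (d₁ + d₂) ≡
                                  2 * s₂ + 2 * c₂ + d₂ + (2 * s₁ + 2 * c₁ + d₁)
  regroup = solve-∀

a′-closedForm : ∀ k ℓ → a′ (suc k) (suc k + ℓ) ≡ closedForm (suc k) ℓ
a′-closedForm zero ℓ = trans (a′-1 ℓ) (sym (closedForm-1 ℓ))
a′-closedForm (suc k) zero = begin
  a′ (suc (suc k)) (suc (suc k) + 0)  ≡⟨ cong (a′ (suc (suc k))) (+-identityʳ (suc (suc k))) ⟩
  a′ (suc (suc k)) (suc (suc k))      ≡⟨ a′-diag (suc k) ⟩
  2 * a′ (suc (suc k)) (suc k)        ≡⟨ cong (2 *_) (a′-below-diag {suc (suc k)} {suc k} ≤-refl) ⟩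
  2 * F (suc (suc k))                 ≡⟨ closedForm-zero k ⟨
  closedForm (suc (suc k)) 0          ∎
a′-closedForm (suc k) (suc ℓ) = begin
  a′ (suc (suc k)) (suc (suc k) + suc ℓ)
    ≡⟨ cong (a′ (suc (suc k))) (+-suc (suc (suc k)) ℓ) ⟩
  a′ (suc (suc k)) (suc (suc (suc (k + ℓ))))
    ≡⟨ a′-off-diag (λ e → <-irrefl (suc-injective (suc-injective e)) (s≤s (m≤m+n k ℓ))) ⟩
  a′ (suc (suc k)) (suc (suc k) + ℓ) + a′ (suc k) (suc k + ℓ)
    ≡⟨ cong₂ _+_ (a′-closedForm (suc k) ℓ) (a′-closedForm k ℓ) ⟩
  closedForm (suc (suc k)) ℓ + closedForm (suc k) ℓ
    ≡⟨ closedForm-suc k ℓ ⟨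
  closedForm (suc (suc k)) (suc ℓ) ∎

theorem1p2 : ((ℓ : ℕ) → a 1 (1 + ℓ) ≡ F (ℓ + 2) + 1)
    × ((k ℓ : ℕ) → 2 ≤ k →
        a k (k + ℓ) ≡ 2 * ∑ 0 (k ∸ 2) (λ i → (ℓ C i) * F (k ∸ i))
                      + 2 * (ℓ C (k ∸ 1))
                      + ∑ 1 ℓ (λ j → j C (ℓ ∸ j + k)))
    × ((k m : ℕ) → 2 ≤ k → 1 ≤ m → m < k →
        a k (k ∸ m) ≡ F (k ∸ m + 1))
theorem1p2 = k≡1 , k≥2 , ℓ<0
  where
  k≡1 : (ℓ : ℕ) → a 1 (1 + ℓ) ≡ F (ℓ + 2) + 1
  k≡1 ℓ = trans (a≡a′ 1 (1 + ℓ)) (trans (a′-1 ℓ) (cong (λ n → F n + 1) (+-comm 2 ℓ)))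

  k≥2 : (k ℓ : ℕ) → 2 ≤ k →
        a k (k + ℓ) ≡ 2 * ∑ 0 (k ∸ 2) (λ i → (ℓ C i) * F (k ∸ i))
                      + 2 * (ℓ C (k ∸ 1))
                      + ∑ 1 ℓ (λ j → j C (ℓ ∸ j + k))
  k≥2 (suc zero) ℓ (s≤s ())
  k≥2 (suc (suc k)) ℓ _ = begin
    a (suc (suc k)) (suc (suc k) + ℓ)   ≡⟨ a≡a′ (suc (suc k)) (suc (suc k) + ℓ) ⟩
    a′ (suc (suc k)) (suc (suc k) + ℓ)  ≡⟨ a′-closedForm (suc k) ℓ ⟩
    closedForm (suc (suc k)) ℓ          ≡⟨ cong₂ (λ s d → 2 * s + 2 * (ℓ C suc k) + d)
                                                 (∑≡∑< 0 k (λ i → (ℓ C i) * F (suc (suc k) ∸ i)))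
                                                 (∑≡∑< 1 ℓ (λ j → j C (ℓ ∸ j + suc (suc k)))) ⟨
    _                                   ∎

  ℓ<0 : (k m : ℕ) → 2 ≤ k → 1 ≤ m → m < k → a k (k ∸ m) ≡ F (k ∸ m + 1)
  ℓ<0 k m _ 1≤m m<k = begin
    a k (k ∸ m)      ≡⟨ a≡a′ k (k ∸ m) ⟩
    a′ k (k ∸ m)     ≡⟨ a′-below-diag (∸-monoʳ-< {k} {m} {0} 1≤m (<⇒≤ m<k)) ⟩
    F (suc (k ∸ m))  ≡⟨ cong F (+-comm 1 (k ∸ m)) ⟩
    F (k ∸ m + 1)    ∎
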